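{- Let $y\in Y$ have finite binary representation $y=0.d_1d_2\dots d_n$. Then there are infinitely many integers $i\ge0$ such that the string $d_1d_2\dots d_n$ is a prefix of the sequence of binary digits after the binary point of $\dfrac{2^{\lceil i\log_2 3\rceil-1}}{3^i}$.
   Context: Let $Y$ be the set of rational numbers $y=x/2^n$, where $x$ is an odd positive integer not divisible by $3$ and $n$ is the number of binary digits of $x$ (so $2^{n-1}\le x<2^n$). Equivalently, $Y$ consists of the $y$ with $1/2\le y<1$ and finite binary representation $y=0.1b_1\dots b_{n-2}1$ such that $y2^n$ is not a multiple of $3$. For a number with a finite binary expansion, the digit sequence after the point is padded with zeros. -}

module Defs where

open import Data.Nat using (ℕ; suc; _+_; _*_; _^_; _≤_; _<_; _∸_)
open import Data.Nat.DivMod using (_/_; _%_)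
open import Data.Nat.Divisibility using (_∣_)
open import Data.Nat.Logarithm using (⌈log₂_⌉)
open import Data.Product using (_×_)
open import Relation.Nullary using (¬_)
open import Relation.Binary.PropositionalEquality using (_≡_)

-- k-th binary digit (k ≥ 1) after the binary point of the nonnegative
-- rational a / (suc b):  ⌊ 2^k · a / (b+1) ⌋ mod 2.
digit : ℕ → ℕ → ℕ → ℕ
digit a b k = ((2 ^ k * a) / suc b) % 2

-- x/2^n ∈ Y : x odd, not divisible by 3, and n is the number of binary digits of x.
InY : ℕ → ℕ → Set
InY x n = (x % 2 ≡ 1) × ¬ (3 ∣ x) × (2 ^ (n ∸ 1) ≤ x) × (x < 2 ^ n) × (1 ≤ n)

-- ⌈ i log₂ 3 ⌉ = ⌈ log₂ (3^i) ⌉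
m : ℕ → ℕ
m i = ⌈log₂ (3 ^ i) ⌉

-- The string d₁…dₙ of binary digits of y = x/2^n is a prefix of the binary
-- digits after the point of 2^(m i - 1)/3^i = 2^(m i) / (2·3^i).
PrefixAt : ℕ → ℕ → ℕ → Set
PrefixAt x n i = ∀ k → 1 ≤ k → k ≤ n →
  digit x (2 ^ n ∸ 1) k ≡ digit (2 ^ m i) (2 * 3 ^ i ∸ 1) k

{-# OPTIONS --safe #-}
-- If 2^p ≠ 3^q but their ratio lies strictly between x/(x+1) and (x+1)/x, then
-- multiplying a fraction 2^E/3^i repeatedly by 2^p/3^q moves it monotonically in steps too
-- small to jump over [x, x+1); starting on the appropriate side, for every N some 2^E/3^i
-- with i ≥ N has floor x. Such p, q exist by the pigeonhole principle: for j = 0, …, x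
-- scale 3^j by a power 2^(e j) into [3^j, 2·3^j); the x + 1 numbers ⌊x 2^(e j)/3^j⌋ lie in
-- [x, 2x), so two coincide. Finally, ⌊2^E/3^i⌋ = x with 2^(n-1) ≤ x < 2^n forces
-- E = m i + n - 1, and then the k-th digit of 2^(m i - 1)/3^i is
-- ⌊2^E/3^i / 2^(n-k)⌋ mod 2 = ⌊x/2^(n-k)⌋ mod 2, the k-th digit of x/2^n.
module Submission where

open import Defs
open import Data.Nat
open import Data.Nat.Properties
open import Data.Nat.DivMod
open import Data.Nat.Logarithm
open import Data.Nat.Tactic.RingSolver using (solve-∀)
open import Algebra.Properties.CommutativeSemigroup *-commutativeSemigroup
  using (x∙yz≈y∙xz; x∙yz≈z∙yx; x∙yz≈xz∙y; x∙yz≈yx∙z;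
         xy∙z≈y∙xz; xy∙z≈xz∙y; xy∙z≈x∙zy)
open import Data.Fin using (toℕ; fromℕ<)
import Data.Fin.Properties as Fin
open import Data.Product using (∃-syntax; _×_; _,_; proj₁; proj₂)
open import Data.Empty using (⊥-elim)
open import Relation.Nullary using (yes; no)
open import Relation.Binary using (Tri; tri<; tri≈; tri>)
open import Relation.Binary.PropositionalEquality

infix 4 ⌊_/_⌋≡_

-- A relational ⌊b/a⌋ = x, usable without a NonZero a instance.
record ⌊_/_⌋≡_ (b a x : ℕ) : Set where
  constructor _,_
  field
    lower : x * a ≤ b
    upper : b < suc x * a

/-unique : ∀ {a b x} .{{_ : NonZero a}} → ⌊ b / a ⌋≡ x → b / a ≡ x
/-unique {a} {b} {x} (lo , hi) = ≤-antisym (s≤s⁻¹ (m<n*o⇒m/o<n hi))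
  (subst (_≤ b / a) (m*n/n≡m x a) (/-monoˡ-≤ a lo))

⌊/⌋≡/ : ∀ b a .{{_ : NonZero a}} → ⌊ b / a ⌋≡ (b / a)
⌊/⌋≡/ b a = m/n*n≤m b a ,
  subst (_< suc (b / a) * a) (sym (m≡m%n+[m/n]*n b a)) (+-monoˡ-< (b / a * a) (m%n<n b a))

m*n/o/n≡m/o : ∀ m n o .{{_ : NonZero n}} .{{_ : NonZero o}} → m * n / o / n ≡ m / o
m*n/o/n≡m/o m n o = trans (m/n/o≡m/[n*o] (m * n) o n) (m*n/o*n≡m/o m n o)
  where instance _ = m*n≢0 o n

n<2^n : ∀ n → n < 2 ^ n
n<2^n zero    = z<s
n<2^n (suc n) = subst (suc n <_) (cong (2 ^ n +_) (sym (+-identityʳ (2 ^ n))))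
  (+-mono-≤ (m^n>0 2 n) (n<2^n n))

^-cancelʳ-≤ : ∀ m → 1 < m → ∀ {a b} → m ^ a ≤ m ^ b → a ≤ b
^-cancelʳ-≤ m 1<m m^a≤m^b = ≮⇒≥ (λ b<a → <⇒≱ (^-monoʳ-< m 1<m b<a) m^a≤m^b)

^-split : ∀ m {k n} → k ≤ n → m ^ n ≡ m ^ k * m ^ (n ∸ k)
^-split m {k} {n} k≤n = trans (cong (m ^_) (sym (m+[n∸m]≡n k≤n))) (^-distribˡ-+-* m k (n ∸ k))

^-geometric : ∀ m a b k → m ^ a * (m ^ b) ^ k ≡ m ^ (a + b * k)
^-geometric m a b k = trans (cong (m ^ a *_) (^-*-assoc m b k)) (sym (^-distribˡ-+-* m a (b * k)))

n≤2^e<2*n : ∀ {n} → 1 ≤ n → ∃[ e ] n ≤ 2 ^ e × 2 ^ e < 2 * n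
n≤2^e<2*n {n} 1≤n = search n (<⇒≤ (n<2^n n))
  where
  search : ∀ e → n ≤ 2 ^ e → ∃[ e ] n ≤ 2 ^ e × 2 ^ e < 2 * n
  search e n≤2^e with 2 ^ e <? 2 * n
  ... | yes 2^e<2n = e , n≤2^e , 2^e<2n
  search zero    _ | no 2^e≮2n = ⊥-elim (2^e≮2n (*-monoʳ-≤ 2 1≤n))
  search (suc e) _ | no 2^e≮2n = search e (*-cancelˡ-≤ 2 (≮⇒≥ 2^e≮2n))

3^q%2≡1 : ∀ q → 3 ^ q % 2 ≡ 1
3^q%2≡1 zero    = refl
3^q%2≡1 (suc q) = trans (%-distribˡ-* 3 (3 ^ q) 2) (cong (λ r → 1 * r % 2) (3^q%2≡1 q))

2^p≢3^q : ∀ p q → 1 ≤ q → 2 ^ p ≢ 3 ^ q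
2^p≢3^q zero    (suc q) _ = <⇒≢ (≤-trans (s≤s (s≤s z≤n)) (*-monoʳ-≤ 3 (m^n>0 3 q)))
2^p≢3^q (suc p) q       _ eq = 0≢1+n (begin
  0               ≡⟨ sym (m*n%n≡0 (2 ^ p) 2) ⟩
  2 ^ p * 2 % 2   ≡⟨ cong (_% 2) (trans (*-comm (2 ^ p) 2) eq) ⟩
  3 ^ q % 2       ≡⟨ 3^q%2≡1 q ⟩
  1               ∎)
  where open ≡-Reasoning

bernoulli : ∀ d K → d ^ K * (d + K) ≤ d * suc d ^ K
bernoulli d zero    =
  ≤-reflexive (trans (+-identityʳ (d + 0)) (trans (+-identityʳ d) (sym (*-identityʳ d))))
bernoulli d (suc K) = begin
  d * d ^ K * (d + suc K)    ≡⟨ xy∙z≈y∙xz d (d ^ K) (d + suc K) ⟩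
  d ^ K * (d * (d + suc K))  ≤⟨ *-monoʳ-≤ (d ^ K) (≤-trans (m≤m+n _ K) (≤-reflexive (expand d K))) ⟩
  d ^ K * (suc d * (d + K))  ≡⟨ x∙yz≈y∙xz (d ^ K) (suc d) (d + K) ⟩
  suc d * (d ^ K * (d + K))  ≤⟨ *-monoʳ-≤ (suc d) (bernoulli d K) ⟩
  suc d * (d * suc d ^ K)    ≡⟨ x∙yz≈y∙xz (suc d) d (suc d ^ K) ⟩
  d * suc d ^ suc K          ∎
  where
  open ≤-Reasoning
  expand : ∀ d K → d * (d + suc K) + K ≡ suc d * (d + K)
  expand = solve-∀

C*d^K≤c^K-eventually : ∀ C {c d} .{{_ : NonZero d}} → d < c → ∃[ K ] C * d ^ K ≤ c ^ K
C*d^K≤c^K-eventually C {c} {d} d<c = K , *-cancelˡ-≤ d (begin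
  d * (C * d ^ K)  ≡⟨ x∙yz≈z∙yx d C (d ^ K) ⟩
  d ^ K * K        ≤⟨ *-monoʳ-≤ (d ^ K) (m≤n+m K d) ⟩
  d ^ K * (d + K)  ≤⟨ bernoulli d K ⟩
  d * suc d ^ K    ≤⟨ *-monoʳ-≤ d (^-monoˡ-≤ K d<c) ⟩
  d * c ^ K        ∎)
  where
  open ≤-Reasoning
  K = C * d

1+n≤⌈log₂[1+2^n]⌉ : ∀ n → suc n ≤ ⌈log₂ (suc (2 ^ n)) ⌉
1+n≤⌈log₂[1+2^n]⌉ zero    = ≤-reflexive (sym (⌈log₂2^n⌉≡n 1))
1+n≤⌈log₂[1+2^n]⌉ (suc n) = suc-≤-∸1 (subst (suc n ≤_) log-halved (1+n≤⌈log₂[1+2^n]⌉ n))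
  where
  halve : ∀ k → suc k ≡ ⌈ suc (2 * k) /2⌉
  halve k = cong suc (trans (n≡⌊n+n/2⌋ k) (cong (λ j → ⌊ k + j /2⌋) (sym (+-identityʳ k))))
  log-halved : ⌈log₂ (suc (2 ^ n)) ⌉ ≡ ⌈log₂ (suc (2 ^ suc n)) ⌉ ∸ 1
  log-halved = trans (cong ⌈log₂_⌉ (halve (2 ^ n))) (⌈log₂⌈n/2⌉⌉≡⌈log₂n⌉∸1 (suc (2 ^ suc n)))
  suc-≤-∸1 : ∀ {m X} → suc m ≤ X ∸ 1 → suc (suc m) ≤ X
  suc-≤-∸1 {X = suc X} le = s≤s le

⌈log₂⌉-unique : ∀ {b r} → b ≤ 2 ^ r → 2 ^ r < 2 * b → ⌈log₂ b ⌉ ≡ r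
⌈log₂⌉-unique {b} {r} b≤2^r 2^r<2b = ≤-antisym
  (subst (⌈log₂ b ⌉ ≤_) (⌈log₂2^n⌉≡n r) (⌈log₂⌉-mono-≤ b≤2^r))
  (lower r 2^r<2b)
  where
  lower : ∀ r → 2 ^ r < 2 * b → r ≤ ⌈log₂ b ⌉
  lower zero    _      = z≤n
  lower (suc r) 2^r<2b =
    ≤-trans (1+n≤⌈log₂[1+2^n]⌉ r) (⌈log₂⌉-mono-≤ (*-cancelˡ-< 2 (2 ^ r) b 2^r<2b))

⌈log₂⌉+n≡E : ∀ {b n E} → 2 ^ n * b ≤ 2 ^ E → 2 ^ E < 2 ^ n * (2 * b) → ⌈log₂ b ⌉ + n ≡ E
⌈log₂⌉+n≡E {zero}  {n} {E} _ hi = ⊥-elim (n≮0 (subst (2 ^ E <_) (*-zeroʳ (2 ^ n)) hi))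
⌈log₂⌉+n≡E {suc b} {n} {E} lo hi =
  trans (cong (_+ n) (⌈log₂⌉-unique (*-cancelˡ-≤ (2 ^ n) (subst (_ ≤_) (^-split 2 n≤E) lo))
                                    (*-cancelˡ-< (2 ^ n) _ _ (subst (_< _) (^-split 2 n≤E) hi))))
        (trans (+-comm (E ∸ n) n) (m+[n∸m]≡n n≤E))
  where
  instance _ = m^n≢0 2 n
  n≤E : n ≤ E
  n≤E = ^-cancelʳ-≤ 2 (s≤s (s≤s z≤n)) (≤-trans (m≤m*n (2 ^ n) (suc b)) lo)

digit-scaled : ∀ x k d .{{_ : NonZero d}} → digit x (2 ^ k * d ∸ 1) k ≡ x / d % 2
digit-scaled x k d = cong (_% 2) (begin
  2 ^ k * x / suc (2 ^ k * d ∸ 1)  ≡⟨ /-congʳ (m+[n∸m]≡n (>-nonZero⁻¹ (2 ^ k * d))) ⟩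
  2 ^ k * x / (2 ^ k * d)          ≡⟨ m*n/m*o≡n/o (2 ^ k) x d ⟩
  x / d                            ∎)
  where
  open ≡-Reasoning
  instance
    _ = m^n≢0 2 k
    _ = m*n≢0 (2 ^ k) d

prefix-from-floor : ∀ {x n i E} → 2 ^ n ≤ x → x < 2 ^ suc n → ⌊ 2 ^ E / 3 ^ i ⌋≡ x →
                    PrefixAt x (suc n) i
prefix-from-floor {x} {n} {i} {E} lo hi floor@(x*3^i≤2^E , 2^E<[1+x]*3^i) k _ k≤1+n = begin
  digit x (2 ^ suc n ∸ 1) k                  ≡⟨ cong (λ t → digit x (t ∸ 1) k) (^-split 2 k≤1+n) ⟩
  digit x (2 ^ k * 2 ^ j ∸ 1) k              ≡⟨ digit-scaled x k (2 ^ j) ⟩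
  x / 2 ^ j % 2                              ≡⟨ cong (λ y → y / 2 ^ j % 2) (sym (/-unique floor)) ⟩
  2 ^ E / 3 ^ i / 2 ^ j % 2                  ≡⟨ cong (_% 2) (sym quotient) ⟩
  digit (2 ^ m i) (2 * 3 ^ i ∸ 1) k          ∎
  where
  open ≡-Reasoning
  j = suc n ∸ k
  instance
    _ = m^n≢0 2 j
    _ = m^n≢0 3 i
    _ = m*n≢0 2 (3 ^ i)
  m+n≡E : m i + n ≡ E
  m+n≡E = ⌈log₂⌉+n≡E {3 ^ i} {n} (≤-trans (*-monoˡ-≤ (3 ^ i) lo) x*3^i≤2^E)
    (<-≤-trans 2^E<[1+x]*3^i
      (≤-trans (*-monoˡ-≤ (3 ^ i) hi) (≤-reflexive (xy∙z≈y∙xz 2 (2 ^ n) (3 ^ i)))))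
  powers : 2 ^ k * 2 ^ m i * 2 ^ j ≡ 2 * 2 ^ E
  powers = begin
    2 ^ k * 2 ^ m i * 2 ^ j    ≡⟨ xy∙z≈y∙xz (2 ^ k) (2 ^ m i) (2 ^ j) ⟩
    2 ^ m i * (2 ^ k * 2 ^ j)  ≡⟨ cong (2 ^ m i *_) (sym (^-split 2 k≤1+n)) ⟩
    2 ^ m i * 2 ^ suc n        ≡⟨ sym (^-distribˡ-+-* 2 (m i) (suc n)) ⟩
    2 ^ (m i + suc n)          ≡⟨ cong (2 ^_) (trans (+-suc (m i) n) (cong suc m+n≡E)) ⟩
    2 * 2 ^ E                  ∎
  quotient : 2 ^ k * 2 ^ m i / suc (2 * 3 ^ i ∸ 1) ≡ 2 ^ E / 3 ^ i / 2 ^ j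
  quotient = begin
    2 ^ k * 2 ^ m i / suc (2 * 3 ^ i ∸ 1)
      ≡⟨ /-congʳ (m+[n∸m]≡n (>-nonZero⁻¹ (2 * 3 ^ i))) ⟩
    2 ^ k * 2 ^ m i / (2 * 3 ^ i)
      ≡⟨ sym (m*n/o/n≡m/o (2 ^ k * 2 ^ m i) (2 ^ j) (2 * 3 ^ i)) ⟩
    2 ^ k * 2 ^ m i * 2 ^ j / (2 * 3 ^ i) / 2 ^ j
      ≡⟨ cong (λ t → t / (2 * 3 ^ i) / 2 ^ j) powers ⟩
    2 * 2 ^ E / (2 * 3 ^ i) / 2 ^ j
      ≡⟨ cong (_/ 2 ^ j) (m*n/m*o≡n/o 2 (2 ^ E) (3 ^ i)) ⟩
    2 ^ E / 3 ^ i / 2 ^ j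
      ∎

-- A power of 2 close to a power of 3

record Near (x c d : ℕ) : Set where
  constructor _,_
  field
    below : x * c < suc x * d
    above : x * d < suc x * c

ratio-antitone : ∀ {x L a b} → 1 ≤ x → x ≤ L → L * a < suc L * b → x * a < suc x * b
ratio-antitone {x} {L} {a} {b} 1≤x x≤L La<[1+L]b = *-cancelˡ-< L _ _ (begin-strict
  L * (x * a)          ≡⟨ x∙yz≈y∙xz L x a ⟩
  x * (L * a)          <⟨ *-monoʳ-< x {{>-nonZero 1≤x}} La<[1+L]b ⟩
  x * (b + L * b)      ≡⟨ *-distribˡ-+ x b (L * b) ⟩
  x * b + x * (L * b)  ≡⟨ cong (x * b +_) (x∙yz≈y∙xz x L b) ⟩
  x * b + L * (x * b)  ≤⟨ +-monoˡ-≤ (L * (x * b)) (*-monoˡ-≤ b x≤L) ⟩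
  L * b + L * (x * b)  ≡⟨ sym (*-distribˡ-+ L b (x * b)) ⟩
  L * (suc x * b)      ∎)
  where open ≤-Reasoning

Near-antitone : ∀ {x L c d} → 1 ≤ x → x ≤ L → Near L c d → Near x c d
Near-antitone 1≤x x≤L (close , close′) =
  ratio-antitone 1≤x x≤L close , ratio-antitone 1≤x x≤L close′

near-of-floors : ∀ {X B c d L} .{{_ : NonZero c}} →
                 ⌊ X / B ⌋≡ L → ⌊ X * c / B * d ⌋≡ L → Near L c d
near-of-floors {X} {B} {c} {d} {L} (lo , hi) (lo′ , hi′) =
  *-cancelʳ-< B (L * c) (suc L * d) (begin-strict
    L * c * B        ≡⟨ xy∙z≈xz∙y L c B ⟩
    L * B * c        ≤⟨ *-monoˡ-≤ c lo ⟩
    X * c            <⟨ hi′ ⟩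
    suc L * (B * d)  ≡⟨ x∙yz≈xz∙y (suc L) B d ⟩
    suc L * d * B    ∎) ,
  *-cancelʳ-< B (L * d) (suc L * c) (begin-strict
    L * d * B        ≡⟨ xy∙z≈x∙zy L d B ⟩
    L * (B * d)      ≤⟨ lo′ ⟩
    X * c            <⟨ *-monoˡ-< c hi ⟩
    suc L * B * c    ≡⟨ xy∙z≈xz∙y (suc L) B c ⟩
    suc L * c * B    ∎)
  where open ≤-Reasoning

pigeonhole-ℕ : ∀ n (f : ℕ → ℕ) → (∀ j → f j < n) → ∃[ a ] ∃[ b ] a < b × f a ≡ f b
pigeonhole-ℕ n f f<n with Fin.pigeonhole (n<1+n n) (λ j → fromℕ< (f<n (toℕ j)))
... | a , b , a<b , same = toℕ a , toℕ b , a<b ,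
  trans (sym (Fin.toℕ-fromℕ< _)) (trans (cong toℕ same) (Fin.toℕ-fromℕ< _))

x≤⌊xA/B⌋<2x : ∀ {x A B u} → 1 ≤ x → B ≤ A → A < 2 * B → ⌊ x * A / B ⌋≡ u →
              x ≤ u × u < 2 * x
x≤⌊xA/B⌋<2x {x} {A} {B} {u} 1≤x B≤A A<2B (lo , hi) =
  s≤s⁻¹ (*-cancelʳ-< B x (suc u) (≤-<-trans (*-monoʳ-≤ x B≤A) hi)) ,
  *-cancelʳ-< B u (2 * x) (≤-<-trans lo (begin-strict
    x * A        <⟨ *-monoʳ-< x {{>-nonZero 1≤x}} A<2B ⟩
    x * (2 * B)  ≡⟨ x∙yz≈yx∙z x 2 B ⟩
    2 * x * B    ∎))
  where open ≤-Reasoning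

dirichlet : ∀ {x} → 1 ≤ x → ∃[ p ] ∃[ q ] 1 ≤ q × Near x (2 ^ p) (3 ^ q)
dirichlet {x} 1≤x = from-collision (pigeonhole-ℕ x (λ j → u j ∸ x) u∸x<x)
  where
  e : ℕ → ℕ
  e j = proj₁ (n≤2^e<2*n (m^n>0 3 j))
  u : ℕ → ℕ
  u j = (x * 2 ^ e j / 3 ^ j) {{m^n≢0 3 j}}
  floor : ∀ j → ⌊ x * 2 ^ e j / 3 ^ j ⌋≡ u j
  floor j = ⌊/⌋≡/ (x * 2 ^ e j) (3 ^ j) {{m^n≢0 3 j}}
  u-bounds : ∀ j → x ≤ u j × u j < 2 * x
  u-bounds j = let _ , 3^j≤2^e , 2^e<2*3^j = n≤2^e<2*n (m^n>0 3 j) in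
    x≤⌊xA/B⌋<2x 1≤x 3^j≤2^e 2^e<2*3^j (floor j)
  u∸x<x : ∀ j → u j ∸ x < x
  u∸x<x j = m<n+o⇒m∸n<o (u j) x {{>-nonZero 1≤x}}
    (subst (u j <_) (cong (x +_) (+-identityʳ x)) (proj₂ (u-bounds j)))
  from-collision : (∃[ a ] ∃[ b ] a < b × u a ∸ x ≡ u b ∸ x) →
                   ∃[ p ] ∃[ q ] 1 ≤ q × Near x (2 ^ p) (3 ^ q)
  from-collision (a , b , a<b , same) = e b ∸ e a , b ∸ a , m<n⇒0<n∸m a<b ,
    Near-antitone 1≤x (proj₁ (u-bounds a))
      (near-of-floors {d = 3 ^ (b ∸ a)} {L = u a} {{m^n≢0 2 (e b ∸ e a)}} (floor a)
        (subst₂ (λ X B → ⌊ X / B ⌋≡ u a) 2-powers 3-powers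
          (subst (⌊ x * 2 ^ e b / 3 ^ b ⌋≡_) (sym u-same) (floor b))))
    where
    u-same : u a ≡ u b
    u-same = ∸-cancelʳ-≡ (proj₁ (u-bounds a)) (proj₁ (u-bounds b)) same
    ea≤eb : e a ≤ e b
    ea≤eb = ^-cancelʳ-≤ 2 (s≤s (s≤s z≤n)) (<⇒≤ (begin-strict
      2 ^ e a      <⟨ proj₂ (proj₂ (n≤2^e<2*n (m^n>0 3 a))) ⟩
      2 * 3 ^ a    ≤⟨ *-monoˡ-≤ (3 ^ a) (n≤1+n 2) ⟩
      3 ^ suc a    ≤⟨ ^-monoʳ-≤ 3 a<b ⟩
      3 ^ b        ≤⟨ proj₁ (proj₂ (n≤2^e<2*n (m^n>0 3 b))) ⟩
      2 ^ e b      ∎))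
      where open ≤-Reasoning
    2-powers : x * 2 ^ e b ≡ x * 2 ^ e a * 2 ^ (e b ∸ e a)
    2-powers = trans (cong (x *_) (^-split 2 ea≤eb)) (sym (*-assoc x _ _))
    3-powers : 3 ^ b ≡ 3 ^ a * 3 ^ (b ∸ a)
    3-powers = ^-split 3 (<⇒≤ a<b)

-- Sweeping through [x, x+1)

⌊⌋≡-geometric₀ : ∀ {a b c d x} → ⌊ b / a ⌋≡ x → ⌊ b * c ^ 0 / a * d ^ 0 ⌋≡ x
⌊⌋≡-geometric₀ {a} {b} {x = x} =
  subst₂ (λ u v → ⌊ u / v ⌋≡ x) (sym (*-identityʳ b)) (sym (*-identityʳ a))

⌊⌋≡-geometricₛ : ∀ {a b c d x} k → ⌊ b * c * c ^ k / a * d * d ^ k ⌋≡ x →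
                ⌊ b * c ^ suc k / a * d ^ suc k ⌋≡ x
⌊⌋≡-geometricₛ {a} {b} {c} {d} {x} k =
  subst₂ (λ u v → ⌊ u / v ⌋≡ x) (*-assoc b c (c ^ k)) (*-assoc a d (d ^ k))

sweep-up : ∀ {x c d} .{{_ : NonZero d}} → x * c < suc x * d →
           ∀ K {a b} .{{_ : NonZero a}} → b < suc x * a → x * (a * d ^ K) ≤ b * c ^ K →
           ∃[ k ] ⌊ b * c ^ k / a * d ^ k ⌋≡ x
sweep-up {x} {c} {d} _ zero {a} {b} below reach =
  0 , ⌊⌋≡-geometric₀ {a} {b} {c} {d}
        (subst₂ _≤_ (cong (x *_) (*-identityʳ a)) (*-identityʳ b) reach , below)
sweep-up {x} {c} {d} xc<[1+x]d (suc K) {a} {b} below reach with x * a ≤? b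
... | yes above = 0 , ⌊⌋≡-geometric₀ {a} {b} {c} {d} (above , below)
... | no  x*a≰b =
  let k , bracket = sweep-up xc<[1+x]d K {a * d} {b * c} {{m*n≢0 a d}} below′
                      (subst₂ (λ u v → x * u ≤ v) (sym (*-assoc a d _)) (sym (*-assoc b c _)) reach)
  in suc k , ⌊⌋≡-geometricₛ {a} {b} {c} {d} k bracket
  where
  open ≤-Reasoning
  below′ : b * c < suc x * (a * d)
  below′ = begin-strict
    b * c            ≤⟨ *-monoˡ-≤ c (<⇒≤ (≰⇒> x*a≰b)) ⟩
    x * a * c        ≡⟨ xy∙z≈y∙xz x a c ⟩
    a * (x * c)      <⟨ *-monoʳ-< a xc<[1+x]d ⟩
    a * (suc x * d)  ≡⟨ x∙yz≈y∙xz a (suc x) d ⟩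
    suc x * (a * d)  ∎

sweep-down : ∀ {x c d} → x * d < suc x * c →
             ∀ K {a b} → x * a ≤ b → b * c ^ K < suc x * (a * d ^ K) →
             ∃[ k ] ⌊ b * c ^ k / a * d ^ k ⌋≡ x
sweep-down {x} {c} {d} _ zero {a} {b} above reach =
  0 , ⌊⌋≡-geometric₀ {a} {b} {c} {d}
        (above , subst₂ _<_ (*-identityʳ b) (cong (suc x *_) (*-identityʳ a)) reach)
sweep-down {x} {c} {d} xd<[1+x]c (suc K) {a} {b} above reach with b <? suc x * a
... | yes below = 0 , ⌊⌋≡-geometric₀ {a} {b} {c} {d} (above , below)
... | no  b≮[1+x]a =
  let k , bracket = sweep-down xd<[1+x]c K {a * d} {b * c} above′
                      (subst₂ (λ u v → u < suc x * v) (sym (*-assoc b c _)) (sym (*-assoc a d _)) reach)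
  in suc k , ⌊⌋≡-geometricₛ {a} {b} {c} {d} k bracket
  where
  open ≤-Reasoning
  above′ : x * (a * d) ≤ b * c
  above′ = begin
    x * (a * d)      ≡⟨ x∙yz≈y∙xz x a d ⟩
    a * (x * d)      ≤⟨ *-monoʳ-≤ a (<⇒≤ xd<[1+x]c) ⟩
    a * (suc x * c)  ≡⟨ x∙yz≈yx∙z a (suc x) c ⟩
    suc x * a * c    ≤⟨ *-monoˡ-≤ c (≮⇒≥ b≮[1+x]a) ⟩
    b * c            ∎

⌊2^E/3^i⌋≡x-infinitely-often : ∀ {x p q} → 1 ≤ x → 1 ≤ q → Near x (2 ^ p) (3 ^ q) →
                               ∀ N → ∃[ i ] ∃[ E ] N ≤ i × ⌊ 2 ^ E / 3 ^ i ⌋≡ x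
⌊2^E/3^i⌋≡x-infinitely-often {x} {p} {q} 1≤x 1≤q (up , down) N = by-cases (<-cmp (2 ^ p) (3 ^ q))
  where
  open ≤-Reasoning
  instance
    _ = m^n≢0 3 N
    _ = m^n≢0 2 p
    _ = m^n≢0 3 q
  E₀ = suc x * 3 ^ N
  in-powers : ∀ F → ∃[ k ] ⌊ 2 ^ F * (2 ^ p) ^ k / 3 ^ N * (3 ^ q) ^ k ⌋≡ x →
              ∃[ i ] ∃[ E ] N ≤ i × ⌊ 2 ^ E / 3 ^ i ⌋≡ x
  in-powers F (k , bracket) = N + q * k , F + p * k , m≤m+n N (q * k) ,
    subst₂ (λ u v → ⌊ u / v ⌋≡ x) (^-geometric 2 F p k) (^-geometric 3 N q k) bracket
  by-cases : Tri (2 ^ p < 3 ^ q) (2 ^ p ≡ 3 ^ q) (2 ^ p > 3 ^ q) →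
             ∃[ i ] ∃[ E ] N ≤ i × ⌊ 2 ^ E / 3 ^ i ⌋≡ x
  by-cases (tri< 2^p<3^q _ _) with C*d^K≤c^K-eventually (2 ^ E₀) 2^p<3^q
  ... | K , dominated = in-powers E₀ (sweep-down down K initial reach)
    where
    initial : x * 3 ^ N ≤ 2 ^ E₀
    initial = ≤-trans (m≤n+m (x * 3 ^ N) (3 ^ N)) (<⇒≤ (n<2^n E₀))
    instance _ = m*n≢0 (3 ^ N) ((3 ^ q) ^ K) {{m^n≢0 3 N}} {{m^n≢0 (3 ^ q) K}}
    reach : 2 ^ E₀ * (2 ^ p) ^ K < suc x * (3 ^ N * (3 ^ q) ^ K)
    reach = begin-strict
      2 ^ E₀ * (2 ^ p) ^ K              ≤⟨ dominated ⟩
      (3 ^ q) ^ K                       ≤⟨ m≤n*m ((3 ^ q) ^ K) (3 ^ N) ⟩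
      3 ^ N * (3 ^ q) ^ K               <⟨ m<m*n (3 ^ N * (3 ^ q) ^ K) (suc x) (s≤s 1≤x) ⟩
      3 ^ N * (3 ^ q) ^ K * suc x       ≡⟨ *-comm (3 ^ N * (3 ^ q) ^ K) (suc x) ⟩
      suc x * (3 ^ N * (3 ^ q) ^ K)     ∎
  by-cases (tri≈ _ 2^p≡3^q _) = ⊥-elim (2^p≢3^q p q 1≤q 2^p≡3^q)
  by-cases (tri> _ _ 3^q<2^p) with C*d^K≤c^K-eventually (x * 3 ^ N) 3^q<2^p
  ... | K , dominated = in-powers 0 (sweep-up up K initial reach)
    where
    initial : 1 < suc x * 3 ^ N
    initial = ≤-trans (s≤s 1≤x) (m≤m*n (suc x) (3 ^ N))
    reach : x * (3 ^ N * (3 ^ q) ^ K) ≤ 1 * (2 ^ p) ^ K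
    reach = begin
      x * (3 ^ N * (3 ^ q) ^ K)  ≡⟨ sym (*-assoc x (3 ^ N) _) ⟩
      x * 3 ^ N * (3 ^ q) ^ K    ≤⟨ dominated ⟩
      (2 ^ p) ^ K                ≡⟨ sym (*-identityˡ _) ⟩
      1 * (2 ^ p) ^ K            ∎

-- Only the bounds 2^(n-1) ≤ x < 2^n of InY are needed; oddness and 3 ∤ x are not.
lemma7 : ∀ x n → InY x n → ∀ N → ∃[ i ] (N ≤ i × PrefixAt x n i)
lemma7 x zero    (_ , _ , _ , _ , ())
lemma7 x (suc n) (_ , _ , 2^n≤x , x<2^[1+n] , _) N =
  let 1≤x = ≤-trans (m^n>0 2 n) 2^n≤x
      p , q , 1≤q , near = dirichlet 1≤x
      i , E , N≤i , floor = ⌊2^E/3^i⌋≡x-infinitely-often {p = p} {q} 1≤x 1≤q near N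
  in i , N≤i , prefix-from-floor {i = i} {E} 2^n≤x x<2^[1+n] floor
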